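{- Let $i\in\{0,1\}$ and $a\in\{1,4,9\}$. The positive integer solutions $(n,y)$ of $2^i5^n=a+y^2$ are exactly: $(1,2)$ if $(i,a)=(0,1)$; $(1,1),(3,11)$ if $(i,a)=(0,4)$; $(2,4)$ if $(i,a)=(0,9)$; $(1,3),(2,7)$ if $(i,a)=(1,1)$; $(1,1),(5,79)$ if $(i,a)=(1,9)$; and there are none if $(i,a)=(1,4)$. -}

module Defs where

open import Data.Nat using (ℕ; suc; _+_; _*_; _^_)
open import Data.Product using (_×_; _,_)
open import Data.List using (List; []; _∷_)
open import Data.List.Membership.Propositional using (_∈_)
open import Relation.Binary.PropositionalEquality using (_≡_)

Eqn : ℕ → ℕ → ℕ → ℕ → Set
Eqn i a n y = 2 ^ i * 5 ^ n ≡ a + y ^ 2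

SolutionsExactly : ℕ → ℕ → List (ℕ × ℕ) → Set
SolutionsExactly i a S =
  ∀ (n y : ℕ) → (Eqn i a (suc n) (suc y) → (suc n , suc y) ∈ S)
              × ((suc n , suc y) ∈ S → Eqn i a (suc n) (suc y))

{-# OPTIONS --safe #-}
-- In the Gaussian integers the equation becomes a statement about elements of norm 5ⁿ. For
-- i = 0 it reads 5ⁿ = k² + y² (a = k²); for i = 1 the solution y is odd, and with a = c² it reads
-- 5ⁿ = x² + t² where x = (y + c)/2, t = (y − c)/2. Descending along the prime π = 2 + i shows
-- that an element of norm 5ⁿ whose coordinates are not both divisible by 5 is a unit times πⁿ
-- or the conjugate of one, so the known quantity k or c equals re (w πⁿ) for one of finitely
-- many w, and it remains to solve re (w πⁿ) = c in n. Modulo 1632 = 2⁵·3·17 the powers of π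
-- have period 16, which rules out most residues of n mod 16, and each remaining residue r
-- carries at most one solution by Skolem's 2-adic argument: π¹⁶ = 1 + 32δ and
-- (1 + 32δ)ᵐ = 1 + 32·2^ν(m)·(m′δ + 16s) with m′ odd, so a second solution r + 16m would force
-- 16 ∣ re (w πʳ δ). A finite computation over r < 16 then leaves the listed exponents.
-- Parity rules out even y for i = 1, and all y when a = 4.
module Submission where

open import Defs
open import Data.Nat.Base as ℕ using (ℕ; zero; suc; _<_; z<s; _^_)
import Data.Nat.Properties as ℕₚ
import Data.Nat.Divisibility as ℕᵈ
open import Data.Nat.DivMod using (_%_; _/_; m≡m%n+[m/n]*n; m%n<n)
open import Data.Nat.Induction using (<-rec)
open import Data.Nat.Primality using (Prime; prime?; euclidsLemma)
import Data.Nat.Tactic.RingSolver as ℕ-Solver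
open import Data.Integer.Base as ℤ using (ℤ; +_; -[1+_]; _+_; _*_; -_; _-_)
import Data.Integer.Properties as ℤₚ
open import Data.Integer.Divisibility.Signed
  using (_∣_; divides; _∣?_; ∣ᵤ⇒∣; ∣⇒∣ᵤ; ∣-refl; ∣m∣n⇒∣m+n; ∣m∣n⇒∣m-n; ∣m⇒∣-m; ∣n⇒∣m*n; ∣m⇒∣m*n; ∣m+n∣n⇒∣m)
open import Data.Integer.Tactic.RingSolver using (solve-∀)
open import Data.Fin.Base using (Fin; toℕ; fromℕ<)
import Data.Fin.Properties as Finₚ
open import Data.Product.Base using (_×_; _,_; proj₁; proj₂; ∃)
open import Data.Sum.Base as Sum using (_⊎_; inj₁; inj₂)
open import Data.Empty using (⊥-elim)
open import Data.List.Base using (List; []; _∷_; map; _++_)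
open import Data.List.Relation.Unary.Any using (here; there)
import Data.List.Relation.Unary.All as All
open import Data.List.Membership.Propositional using (_∈_)
open import Data.List.Membership.Propositional.Properties using (∈-map⁺; ∈-++⁺ˡ; ∈-++⁺ʳ)
open import Data.List.Membership.DecPropositional ℕₚ._≟_ using (_∈?_)
open import Function.Base using (_∘_; id)
open import Relation.Binary.Definitions using (tri<; tri≈; tri>)
open import Relation.Nullary.Negation using (¬_)
open import Relation.Nullary.Decidable
  using (Dec; ¬?; _⊎-dec_; _×-dec_; True; False; toWitness; toWitnessFalse; from-yes)
open import Relation.Binary.PropositionalEquality

Gaussian : Set
Gaussian = ℤ × ℤ

re im : Gaussian → ℤ
re = proj₁
im = proj₂

infixl 6 _+ᵍ_
infixl 7 _·_
infixr 7 _⊙_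
infixr 8 _^ᵍ_
infix 4 _∣ᵍ_

_+ᵍ_ : Gaussian → Gaussian → Gaussian
(a , b) +ᵍ (c , d) = (a + c , b + d)

_⊙_ : ℤ → Gaussian → Gaussian
k ⊙ (a , b) = (k * a , k * b)

_·_ : Gaussian → Gaussian → Gaussian
(a , b) · (c , d) = (a * c - b * d , a * d + b * c)

1ᵍ : Gaussian
1ᵍ = (+ 1 , + 0)

_^ᵍ_ : Gaussian → ℕ → Gaussian
p ^ᵍ zero  = 1ᵍ
p ^ᵍ suc n = p · p ^ᵍ n

conj : Gaussian → Gaussian
conj (a , b) = (a , - b)

norm : Gaussian → ℤ
norm (a , b) = a * a + b * b

_∣ᵍ_ : ℤ → Gaussian → Set
k ∣ᵍ p = (k ∣ re p) × (k ∣ im p)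

·-comm : ∀ p q → p · q ≡ q · p
·-comm (a , b) (c , d) = cong₂ _,_ (re-eq a b c d) (im-eq a b c d)
  where
  re-eq : ∀ a b c d → a * c - b * d ≡ c * a - d * b
  re-eq = solve-∀
  im-eq : ∀ a b c d → a * d + b * c ≡ c * b + d * a
  im-eq = solve-∀

·-assoc : ∀ p q r → p · (q · r) ≡ (p · q) · r
·-assoc (a , b) (c , d) (e , f) = cong₂ _,_ (re-eq a b c d e f) (im-eq a b c d e f)
  where
  re-eq : ∀ a b c d e f → a * (c * e - d * f) - b * (c * f + d * e)
                        ≡ (a * c - b * d) * e - (a * d + b * c) * f
  re-eq = solve-∀
  im-eq : ∀ a b c d e f → a * (c * f + d * e) + b * (c * e - d * f)
                        ≡ (a * c - b * d) * f + (a * d + b * c) * e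
  im-eq = solve-∀

·-left-comm : ∀ p q r → p · (q · r) ≡ q · (p · r)
·-left-comm p q r = begin
  p · (q · r)  ≡⟨ ·-assoc p q r ⟩
  (p · q) · r  ≡⟨ cong (_· r) (·-comm p q) ⟩
  (q · p) · r  ≡⟨ ·-assoc q p r ⟨
  q · (p · r)  ∎
  where open ≡-Reasoning

·-identityˡ : ∀ p → 1ᵍ · p ≡ p
·-identityˡ (a , b) = cong₂ _,_ (re-eq a b) (im-eq a b)
  where
  re-eq : ∀ a b → + 1 * a - + 0 * b ≡ a
  re-eq = solve-∀
  im-eq : ∀ a b → + 1 * b + + 0 * a ≡ b
  im-eq = solve-∀

·-identityʳ : ∀ p → p · 1ᵍ ≡ p
·-identityʳ p = trans (·-comm p 1ᵍ) (·-identityˡ p)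

^ᵍ-+ : ∀ p m n → p ^ᵍ (m ℕ.+ n) ≡ p ^ᵍ m · p ^ᵍ n
^ᵍ-+ p zero    n = sym (·-identityˡ (p ^ᵍ n))
^ᵍ-+ p (suc m) n = trans (cong (p ·_) (^ᵍ-+ p m n)) (·-assoc p (p ^ᵍ m) (p ^ᵍ n))

^ᵍ-* : ∀ p m k → p ^ᵍ (m ℕ.* k) ≡ (p ^ᵍ k) ^ᵍ m
^ᵍ-* p zero    k = refl
^ᵍ-* p (suc m) k = trans (^ᵍ-+ p k (m ℕ.* k)) (cong (p ^ᵍ k ·_) (^ᵍ-* p m k))

conj-involutive : ∀ p → conj (conj p) ≡ p
conj-involutive (a , b) = cong (a ,_) (ℤₚ.neg-involutive b)

conj-· : ∀ p q → conj (p · q) ≡ conj p · conj q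
conj-· (a , b) (c , d) = cong₂ _,_ (re-eq a b c d) (im-eq a b c d)
  where
  re-eq : ∀ a b c d → a * c - b * d ≡ a * c - (- b) * (- d)
  re-eq = solve-∀
  im-eq : ∀ a b c d → - (a * d + b * c) ≡ a * (- d) + (- b) * c
  im-eq = solve-∀

norm-· : ∀ p q → norm (p · q) ≡ norm p * norm q
norm-· (a , b) (c , d) = brahmagupta a b c d
  where
  brahmagupta : ∀ a b c d → (a * c - b * d) * (a * c - b * d) + (a * d + b * c) * (a * d + b * c)
                           ≡ (a * a + b * b) * (c * c + d * d)
  brahmagupta = solve-∀

norm-conj : ∀ p → norm (conj p) ≡ norm p
norm-conj (a , b) = square-neg a b
  where
  square-neg : ∀ a b → a * a + (- b) * (- b) ≡ a * a + b * b
  square-neg = solve-∀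

∣ᵍ-·ˡ : ∀ {k} p {q} → k ∣ᵍ q → k ∣ᵍ p · q
∣ᵍ-·ˡ (a , b) (k∣c , k∣d) =
  ∣m∣n⇒∣m-n (∣n⇒∣m*n a k∣c) (∣n⇒∣m*n b k∣d) , ∣m∣n⇒∣m+n (∣n⇒∣m*n a k∣d) (∣n⇒∣m*n b k∣c)

∣ᵍ-conj : ∀ {k p} → k ∣ᵍ p → k ∣ᵍ conj p
∣ᵍ-conj (k∣a , k∣b) = k∣a , ∣m⇒∣-m k∣b

prime-∣*⇒∣⊎∣ : ∀ {p} → Prime p → ∀ i j → + p ∣ i * j → + p ∣ i ⊎ + p ∣ j
prime-∣*⇒∣⊎∣ {p} p-prime i j p∣ij =
  Sum.map ∣ᵤ⇒∣ ∣ᵤ⇒∣ (euclidsLemma ℤ.∣ i ∣ ℤ.∣ j ∣ p-prime (subst (p ℕᵈ.∣_) (ℤₚ.abs-* i j) (∣⇒∣ᵤ p∣ij)))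

units : List Gaussian
units = 1ᵍ ∷ (- + 1 , + 0) ∷ (+ 0 , + 1) ∷ (+ 0 , - + 1) ∷ []

conj-unit : ∀ {u} → u ∈ units → conj u ∈ units
conj-unit (here refl)                         = here refl
conj-unit (there (here refl))                 = there (here refl)
conj-unit (there (there (here refl)))         = there (there (there (here refl)))
conj-unit (there (there (there (here refl)))) = there (there (here refl))

∣i∣≡1⇒i≡±1 : ∀ i → ℤ.∣ i ∣ ≡ 1 → i ≡ + 1 ⊎ i ≡ - + 1
∣i∣≡1⇒i≡±1 (+ .1)     refl = inj₁ refl
∣i∣≡1⇒i≡±1 -[1+ .0 ] refl = inj₂ refl

m²+n²≡1 : ∀ m n → m ℕ.* m ℕ.+ n ℕ.* n ≡ 1 → (m ≡ 1 × n ≡ 0) ⊎ (m ≡ 0 × n ≡ 1)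
m²+n²≡1 0             1             _ = inj₂ (refl , refl)
m²+n²≡1 1             0             _ = inj₁ (refl , refl)
m²+n²≡1 0             0             ()
m²+n²≡1 0             (suc (suc n)) ()
m²+n²≡1 1             (suc n)       ()
m²+n²≡1 (suc (suc m)) n             ()

norm-abs : ∀ a b → norm (a , b) ≡ + (ℤ.∣ a ∣ ℕ.* ℤ.∣ a ∣ ℕ.+ ℤ.∣ b ∣ ℕ.* ℤ.∣ b ∣)
norm-abs a b = cong₂ _+_ (square-abs a) (square-abs b)
  where
  square-abs : ∀ i → i * i ≡ + (ℤ.∣ i ∣ ℕ.* ℤ.∣ i ∣)
  square-abs (+ n)     = sym (ℤₚ.pos-* n n)
  square-abs -[1+ n ] = refl

norm≡1⇒unit : ∀ p → norm p ≡ + 1 → p ∈ units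
norm≡1⇒unit (a , b) a²+b²≡1
  with m²+n²≡1 ℤ.∣ a ∣ ℤ.∣ b ∣ (ℤₚ.+-injective (trans (sym (norm-abs a b)) a²+b²≡1))
... | inj₁ (∣a∣≡1 , ∣b∣≡0) with ∣i∣≡1⇒i≡±1 a ∣a∣≡1 | ℤₚ.∣i∣≡0⇒i≡0 {b} ∣b∣≡0
...   | inj₁ refl | refl = here refl
...   | inj₂ refl | refl = there (here refl)
norm≡1⇒unit (a , b) _ | inj₂ (∣a∣≡0 , ∣b∣≡1) with ℤₚ.∣i∣≡0⇒i≡0 {a} ∣a∣≡0 | ∣i∣≡1⇒i≡±1 b ∣b∣≡1
...   | refl | inj₁ refl = there (there (here refl))
...   | refl | inj₂ refl = there (there (there (here refl)))

Associated : Gaussian → Gaussian → Set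
Associated p q = ∃ λ u → u ∈ units × p ≡ u · q

AssociatedUpToConj : Gaussian → Gaussian → Set
AssociatedUpToConj p q = Associated p q ⊎ Associated (conj p) q

π : Gaussian
π = (+ 2 , + 1)

π-divides : ∀ p → + 5 ∣ re p - + 2 * im p → ∃ λ q → p ≡ π · q
π-divides (x , t) (divides s x-2t≡5s) = (+ 2 * s + t , - s) , cong₂ _,_ x≡ (t≡ s t)
  where
  open ≡-Reasoning
  t≡ : ∀ s t → t ≡ + 2 * (- s) + + 1 * (+ 2 * s + t)
  t≡ = solve-∀
  x≡ : x ≡ + 2 * (+ 2 * s + t) - + 1 * (- s)
  x≡ = begin
    x                                  ≡⟨ split x t ⟩
    (x - + 2 * t) + + 2 * t            ≡⟨ cong (_+ + 2 * t) x-2t≡5s ⟩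
    s * + 5 + + 2 * t                  ≡⟨ regroup s t ⟩
    + 2 * (+ 2 * s + t) - + 1 * (- s)  ∎
    where
    split : ∀ x t → x ≡ (x - + 2 * t) + + 2 * t
    split = solve-∀
    regroup : ∀ s t → s * + 5 + + 2 * t ≡ + 2 * (+ 2 * s + t) - + 1 * (- s)
    regroup = solve-∀

π-or-conj-divides : ∀ p m → norm p ≡ + 5 * m →
                    + 5 ∣ re p - + 2 * im p ⊎ + 5 ∣ re (conj p) - + 2 * im (conj p)
π-or-conj-divides (x , t) m x²+t²≡5m =
  prime-∣*⇒∣⊎∣ (from-yes (prime? 5)) (x - + 2 * t) (x - + 2 * (- t)) (divides (m - t * t) (begin
    (x - + 2 * t) * (x - + 2 * (- t))  ≡⟨ factor x t ⟩
    (x * x + t * t) - + 5 * (t * t)   ≡⟨ cong (_- + 5 * (t * t)) x²+t²≡5m ⟩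
    + 5 * m - + 5 * (t * t)           ≡⟨ collect m t ⟩
    (m - t * t) * + 5                 ∎))
  where
  open ≡-Reasoning
  factor : ∀ x t → (x - + 2 * t) * (x - + 2 * (- t)) ≡ (x * x + t * t) - + 5 * (t * t)
  factor = solve-∀
  collect : ∀ m t → + 5 * m - + 5 * (t * t) ≡ (m - t * t) * + 5
  collect = solve-∀

5∣ᵍπ·conj[v·π] : ∀ v → + 5 ∣ᵍ π · conj (v · π)
5∣ᵍπ·conj[v·π] (a , b) = divides a (re-eq a b) , divides (- b) (im-eq a b)
  where
  re-eq : ∀ a b → + 2 * (a * + 2 - b * + 1) - + 1 * (- (a * + 1 + b * + 2)) ≡ a * + 5
  re-eq = solve-∀
  im-eq : ∀ a b → + 2 * (- (a * + 1 + b * + 2)) + + 1 * (a * + 2 - b * + 1) ≡ (- b) * + 5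
  im-eq = solve-∀

π·-associated : ∀ k {p q} → p ≡ π · q → ¬ (+ 5 ∣ᵍ p) →
                AssociatedUpToConj q (π ^ᵍ k) → Associated p (π ^ᵍ suc k)
π·-associated k p≡πq _ (inj₁ (u , u∈ , q≡uπᵏ)) =
  u , u∈ , trans p≡πq (trans (cong (π ·_) q≡uπᵏ) (·-left-comm π u (π ^ᵍ k)))
π·-associated zero {p} {q} p≡πq _ (inj₂ (u , u∈ , q̄≡u1)) = conj u , conj-unit u∈ , (begin
  p                 ≡⟨ p≡πq ⟩
  π · q             ≡⟨ cong (π ·_) (conj-involutive q) ⟨
  π · conj (conj q) ≡⟨ cong (λ z → π · conj z) (trans q̄≡u1 (·-identityʳ u)) ⟩
  π · conj u        ≡⟨ ·-comm π (conj u) ⟩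
  conj u · π        ∎)
  where open ≡-Reasoning
π·-associated (suc j) {p} {q} p≡πq 5∤p (inj₂ (u , _ , q̄≡uπʲ⁺¹)) =
  ⊥-elim (5∤p (subst (+ 5 ∣ᵍ_) (sym p≡) (5∣ᵍπ·conj[v·π] (u · π ^ᵍ j))))
  where
  open ≡-Reasoning
  p≡ : p ≡ π · conj (u · π ^ᵍ j · π)
  p≡ = begin
    p                              ≡⟨ p≡πq ⟩
    π · q                          ≡⟨ cong (π ·_) (conj-involutive q) ⟨
    π · conj (conj q)              ≡⟨ cong (λ z → π · conj z) q̄≡uπʲ⁺¹ ⟩
    π · conj (u · (π · π ^ᵍ j))    ≡⟨ cong (λ z → π · conj z) (·-left-comm u π (π ^ᵍ j)) ⟩
    π · conj (π · (u · π ^ᵍ j))    ≡⟨ cong (λ z → π · conj z) (·-comm π (u · π ^ᵍ j)) ⟩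
    π · conj (u · π ^ᵍ j · π)      ∎

descent : ∀ n p → norm p ≡ + (5 ^ n) → ¬ (+ 5 ∣ᵍ p) → AssociatedUpToConj p (π ^ᵍ n)
π-divided : ∀ k p → norm p ≡ + (5 ^ suc k) → ¬ (+ 5 ∣ᵍ p) → + 5 ∣ re p - + 2 * im p →
            Associated p (π ^ᵍ suc k)

descent zero    p n≡1 _ = inj₁ (p , norm≡1⇒unit p n≡1 , sym (·-identityʳ p))
descent (suc k) p np 5∤p with π-or-conj-divides p (+ (5 ^ k)) (trans np (ℤₚ.pos-* 5 (5 ^ k)))
... | inj₁ 5∣ = inj₁ (π-divided k p np 5∤p 5∣)
... | inj₂ 5∣ = inj₂ (π-divided k (conj p) (trans (norm-conj p) np) 5∤p̄ 5∣)
  where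
  5∤p̄ : ¬ (+ 5 ∣ᵍ conj p)
  5∤p̄ 5∣p̄ = 5∤p (subst (+ 5 ∣ᵍ_) (conj-involutive p) (∣ᵍ-conj 5∣p̄))

π-divided k p np 5∤p 5∣ with π-divides p 5∣
... | q , p≡πq = π·-associated k p≡πq 5∤p (descent k q nq 5∤q)
  where
  open ≡-Reasoning
  nq : norm q ≡ + (5 ^ k)
  nq = ℤₚ.*-cancelˡ-≡ (+ 5) (norm q) (+ (5 ^ k)) (begin
    + 5 * norm q         ≡⟨ norm-· π q ⟨
    norm (π · q)         ≡⟨ cong norm p≡πq ⟨
    norm p               ≡⟨ np ⟩
    + (5 ^ suc k)        ≡⟨ ℤₚ.pos-* 5 (5 ^ k) ⟩
    + 5 * + (5 ^ k)      ∎)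
  5∤q : ¬ (+ 5 ∣ᵍ q)
  5∤q 5∣q = 5∤p (subst (+ 5 ∣ᵍ_) (sym p≡πq) (∣ᵍ-·ˡ π 5∣q))

re-·-1+ : ∀ h M e → re (h · (1ᵍ +ᵍ M ⊙ e)) ≡ re h + M * re (h · e)
re-·-1+ (a , b) M (c , d) = identity a b M c d
  where
  identity : ∀ a b M c d → a * (+ 1 + M * c) - b * (+ 0 + M * d) ≡ a + M * (a * c - b * d)
  identity = solve-∀

re-·-lincomb : ∀ h a p b q → re (h · (a ⊙ p +ᵍ b ⊙ q)) ≡ a * re (h · p) + b * re (h · q)
re-·-lincomb (h₁ , h₂) a (p₁ , p₂) b (q₁ , q₂) = identity h₁ h₂ a p₁ p₂ b q₁ q₂
  where
  identity : ∀ h₁ h₂ a p₁ p₂ b q₁ q₂ →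
    h₁ * (a * p₁ + b * q₁) - h₂ * (a * p₂ + b * q₂) ≡ a * (h₁ * p₁ - h₂ * p₂) + b * (h₁ * q₁ - h₂ * q₂)
  identity = solve-∀

·-1+ : ∀ M d g → (1ᵍ +ᵍ M ⊙ d) · (1ᵍ +ᵍ M ⊙ g) ≡ 1ᵍ +ᵍ M ⊙ (d +ᵍ g +ᵍ M ⊙ (d · g))
·-1+ M (d₁ , d₂) (g₁ , g₂) = cong₂ _,_ (re-eq M d₁ d₂ g₁ g₂) (im-eq M d₁ d₂ g₁ g₂)
  where
  re-eq : ∀ M d₁ d₂ g₁ g₂ → (+ 1 + M * d₁) * (+ 1 + M * g₁) - (+ 0 + M * d₂) * (+ 0 + M * g₂)
                          ≡ + 1 + M * (d₁ + g₁ + M * (d₁ * g₁ - d₂ * g₂))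
  re-eq = solve-∀
  im-eq : ∀ M d₁ d₂ g₁ g₂ → (+ 1 + M * d₁) * (+ 0 + M * g₂) + (+ 0 + M * d₂) * (+ 1 + M * g₁)
                          ≡ + 0 + M * (d₂ + g₂ + M * (d₁ * g₂ + d₂ * g₁))
  im-eq = solve-∀

^ᵍ-binomial : ∀ {X M d} → X ≡ 1ᵍ +ᵍ M ⊙ d → ∀ k → ∃ λ r → X ^ᵍ k ≡ 1ᵍ +ᵍ M ⊙ (+ k ⊙ d +ᵍ M ⊙ r)
^ᵍ-binomial {M = M} {d₁ , d₂} _ zero = (+ 0 , + 0) , cong₂ _,_ (vanish (+ 1) M d₁) (vanish (+ 0) M d₂)
  where
  vanish : ∀ a M d → a ≡ a + M * (+ 0 * d + M * + 0)
  vanish = solve-∀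
^ᵍ-binomial {X} {M} {d} X≡ (suc k) =
  let r , Xᵏ≡ = ^ᵍ-binomial {X} {M} {d} X≡ k
      g       = + k ⊙ d +ᵍ M ⊙ r
  in r +ᵍ d · g , (begin
  X · X ^ᵍ k                                      ≡⟨ cong₂ _·_ X≡ Xᵏ≡ ⟩
  (1ᵍ +ᵍ M ⊙ d) · (1ᵍ +ᵍ M ⊙ g)                   ≡⟨ ·-1+ M d g ⟩
  1ᵍ +ᵍ M ⊙ (d +ᵍ g +ᵍ M ⊙ (d · g))               ≡⟨ cong (λ z → 1ᵍ +ᵍ M ⊙ z) (collect d r (d · g)) ⟩
  1ᵍ +ᵍ M ⊙ (+ suc k ⊙ d +ᵍ M ⊙ (r +ᵍ d · g))     ∎)
  where
  open ≡-Reasoning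
  collect₁ : ∀ K M d r f → d + (K * d + M * r) + M * f ≡ (+ 1 + K) * d + M * (r + f)
  collect₁ = solve-∀
  collect : ∀ d r f → d +ᵍ (+ k ⊙ d +ᵍ M ⊙ r) +ᵍ M ⊙ f ≡ + suc k ⊙ d +ᵍ M ⊙ (r +ᵍ f)
  collect (d₁ , d₂) (r₁ , r₂) (f₁ , f₂) =
    cong₂ _,_ (collect₁ (+ k) M d₁ r₁ f₁) (collect₁ (+ k) M d₂ r₂ f₂)

16∣odd⁴-1 : ∀ h → let c = + 1 + + 2 * + h in + 16 ∣ c * c * (c * c) - + 1
16∣odd⁴-1 zero    = divides (+ 0) refl
16∣odd⁴-1 (suc h) = subst (+ 16 ∣_) (step (+ h)) (∣m∣n⇒∣m+n (16∣odd⁴-1 h) (∣m⇒∣m*n _ ∣-refl))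
  where
  step : ∀ H → let c = + 1 + + 2 * H; c′ = + 1 + + 2 * (+ 1 + H) in
         (c * c * (c * c) - + 1) + + 16 * (c * c * (+ 2 + H) + + 2 * c + + 1) ≡ c′ * c′ * (c′ * c′) - + 1
  step = solve-∀

∣c⁴-1⇒∣c*v⇒∣v : ∀ {k} c v → k ∣ c * c * (c * c) - + 1 → k ∣ c * v → k ∣ v
∣c⁴-1⇒∣c*v⇒∣v c v k∣c⁴-1 k∣cv =
  subst (_ ∣_) (identity c v) (∣m∣n⇒∣m-n (∣n⇒∣m*n (c * c * c) k∣cv) (∣m⇒∣m*n v k∣c⁴-1))
  where
  identity : ∀ c v → c * c * c * (c * v) - (c * c * (c * c) - + 1) * v ≡ v
  identity = solve-∀

pos-odd : ∀ m → + suc (2 ℕ.* m) ≡ + 1 + + 2 * + m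
pos-odd m = cong (λ z → + 1 + z) (ℤₚ.pos-* 2 m)

-- Intended reading: P = 2^ν₂(m) and c is the odd part of m.
record Expansion₂ (X d : Gaussian) (m : ℕ) : Set where
  field
    P c      : ℤ
    s        : Gaussian
    P≢0      : P ≢ + 0
    16∣c⁴-1  : + 16 ∣ c * c * (c * c) - + 1
    X^m≡     : X ^ᵍ m ≡ 1ᵍ +ᵍ (+ 32 * P) ⊙ (c ⊙ d +ᵍ + 16 ⊙ s)

odd-expansion : ∀ {X d} → X ≡ 1ᵍ +ᵍ + 32 ⊙ d → ∀ h → Expansion₂ X d (suc (2 ℕ.* h))
odd-expansion {X} {d} X≡ h =
  let r , X^m≡ = ^ᵍ-binomial {X} {+ 32} {d} X≡ (suc (2 ℕ.* h)) in record
  { P = + 1 ; c = c ; s = + 2 ⊙ r ; P≢0 = λ () ; 16∣c⁴-1 = 16∣odd⁴-1 h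
  ; X^m≡ = trans X^m≡ (cong (λ z → 1ᵍ +ᵍ + 32 ⊙ z)
                         (cong₂ _+ᵍ_ (cong (_⊙ d) (pos-odd h)) (cong₂ _,_ (32≡16*2 (re r)) (32≡16*2 (im r)))))
  }
  where
  c : ℤ
  c = + 1 + + 2 * + h
  32≡16*2 : ∀ x → + 32 * x ≡ + 16 * (+ 2 * x)
  32≡16*2 = ℤₚ.*-assoc (+ 16) (+ 2)

double-expansion : ∀ {X d k} → Expansion₂ X d k → Expansion₂ X d (2 ℕ.* k)
double-expansion {X} {d} {k} E = record
  { P = + 2 * P ; c = c ; s = s +ᵍ P ⊙ (e · e) ; P≢0 = 2P≢0 ; 16∣c⁴-1 = 16∣c⁴-1
  ; X^m≡ = begin
      X ^ᵍ (2 ℕ.* k)                                    ≡⟨ ^ᵍ-+ X k (k ℕ.+ 0) ⟩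
      X ^ᵍ k · X ^ᵍ (k ℕ.+ 0)                           ≡⟨ cong (λ j → X ^ᵍ k · X ^ᵍ j) (ℕₚ.+-identityʳ k) ⟩
      X ^ᵍ k · X ^ᵍ k                                   ≡⟨ cong₂ _·_ X^m≡ X^m≡ ⟩
      (1ᵍ +ᵍ A ⊙ e) · (1ᵍ +ᵍ A ⊙ e)                     ≡⟨ ·-1+ A e e ⟩
      1ᵍ +ᵍ A ⊙ (e +ᵍ e +ᵍ A ⊙ (e · e))                 ≡⟨ cong (1ᵍ +ᵍ_) (collect (e · e)) ⟩
      1ᵍ +ᵍ (+ 32 * (+ 2 * P)) ⊙ (c ⊙ d +ᵍ + 16 ⊙ (s +ᵍ P ⊙ (e · e))) ∎
  }
  where
  open Expansion₂ E
  open ≡-Reasoning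
  A : ℤ
  A = + 32 * P
  e : Gaussian
  e = c ⊙ d +ᵍ + 16 ⊙ s
  2P≢0 : + 2 * P ≢ + 0
  2P≢0 2P≡0 = P≢0 (ℤₚ.*-cancelˡ-≡ (+ 2) P (+ 0) 2P≡0)
  collect₁ : ∀ P c d s f → (+ 32 * P) * ((c * d + + 16 * s) + (c * d + + 16 * s) + (+ 32 * P) * f)
                         ≡ (+ 32 * (+ 2 * P)) * (c * d + + 16 * (s + P * f))
  collect₁ = solve-∀
  collect : ∀ f → A ⊙ (e +ᵍ e +ᵍ A ⊙ f) ≡ (+ 32 * (+ 2 * P)) ⊙ (c ⊙ d +ᵍ + 16 ⊙ (s +ᵍ P ⊙ f))
  collect f = cong₂ _,_ (collect₁ P c (re d) (re s) (re f)) (collect₁ P c (im d) (im s) (im f))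

even-or-odd : ∀ n → ∃ λ h → n ≡ 2 ℕ.* h ⊎ n ≡ suc (2 ℕ.* h)
even-or-odd zero = 0 , inj₁ refl
even-or-odd (suc n) with even-or-odd n
... | h , inj₁ n≡2h   = h , inj₂ (cong suc n≡2h)
... | h , inj₂ n≡2h+1 = suc h , inj₁ (trans (cong suc n≡2h+1) (sym (ℕₚ.*-suc 2 h)))

expansion : ∀ {X d} → X ≡ 1ᵍ +ᵍ + 32 ⊙ d → ∀ m → Expansion₂ X d (suc m)
expansion {X} {d} X≡ = <-rec (λ m → Expansion₂ X d (suc m)) step
  where
  step : ∀ m → (∀ {j} → j < m → Expansion₂ X d (suc j)) → Expansion₂ X d (suc m)
  step m rec with even-or-odd (suc m)
  ... | h     , inj₂ m+1≡2h+1 = subst (Expansion₂ X d) (sym m+1≡2h+1) (odd-expansion {X} {d} X≡ h)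
  ... | suc h , inj₁ m+1≡2h   = subst (Expansion₂ X d) (sym m+1≡2h) (double-expansion (rec h<m))
    where
    h<m : h < m
    h<m = subst (h <_) (sym (ℕₚ.suc-injective m+1≡2h)) (ℕₚ.m<m+n h z<s)

re-·-^ᵍ-suc≢re : ∀ {X d} → X ≡ 1ᵍ +ᵍ + 32 ⊙ d →
               ∀ h → ¬ (+ 16 ∣ re (h · d)) → ∀ m → re (h · X ^ᵍ suc m) ≢ re h
re-·-^ᵍ-suc≢re {X} {d} X≡ h 16∤v m hXᵐ⁺¹≡h = 16∤v (∣c⁴-1⇒∣c*v⇒∣v c v 16∣c⁴-1 16∣cv)
  where
  open Expansion₂ (expansion {X} {d} X≡ m)
  open ≡-Reasoning
  v u : ℤ
  v = re (h · d)
  u = re (h · s)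
  A : ℤ
  A = + 32 * P
  e : Gaussian
  e = c ⊙ d +ᵍ + 16 ⊙ s
  A[cv+16u]≡0 : A * (c * v + + 16 * u) ≡ + 0
  A[cv+16u]≡0 = begin
    A * (c * v + + 16 * u)          ≡⟨ cong (A *_) (re-·-lincomb h c d (+ 16) s) ⟨
    A * re (h · e)                  ≡⟨ cancel (re h) (A * re (h · e)) ⟩
    (re h + A * re (h · e)) - re h  ≡⟨ cong (_- re h) (re-·-1+ h A e) ⟨
    re (h · (1ᵍ +ᵍ A ⊙ e)) - re h   ≡⟨ cong (λ z → re (h · z) - re h) X^m≡ ⟨
    re (h · X ^ᵍ suc m) - re h      ≡⟨ ℤₚ.i≡j⇒i-j≡0 hXᵐ⁺¹≡h ⟩
    + 0                             ∎
    where
    cancel : ∀ a b → b ≡ (a + b) - a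
    cancel = solve-∀
  cv+16u≡0 : c * v + + 16 * u ≡ + 0
  cv+16u≡0 = Sum.[ (λ A≡0 → ⊥-elim (P≢0 (ℤₚ.*-cancelˡ-≡ (+ 32) P (+ 0) A≡0))) , id ]′
               (ℤₚ.i*j≡0⇒i≡0∨j≡0 A A[cv+16u]≡0)
  16∣cv : + 16 ∣ c * v
  16∣cv = ∣m+n∣n⇒∣m (subst (+ 16 ∣_) (sym cv+16u≡0) (divides (+ 0) refl)) (∣m⇒∣m*n u ∣-refl)

δ : Gaussian
δ = (+ 5151 , + 11067)

π¹⁶≡1+1632 : π ^ᵍ 16 ≡ 1ᵍ +ᵍ + 1632 ⊙ (+ 101 , + 217)
π¹⁶≡1+1632 = refl

π¹⁶≡1+32δ : π ^ᵍ 16 ≡ 1ᵍ +ᵍ + 32 ⊙ δ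
π¹⁶≡1+32δ = refl

·π^-split : ∀ w r m → w · π ^ᵍ (r ℕ.+ m ℕ.* 16) ≡ (w · π ^ᵍ r) · (π ^ᵍ 16) ^ᵍ m
·π^-split w r m = begin
  w · π ^ᵍ (r ℕ.+ m ℕ.* 16)            ≡⟨ cong (w ·_) (^ᵍ-+ π r (m ℕ.* 16)) ⟩
  w · (π ^ᵍ r · π ^ᵍ (m ℕ.* 16))       ≡⟨ cong (λ z → w · (π ^ᵍ r · z)) (^ᵍ-* π m 16) ⟩
  w · (π ^ᵍ r · (π ^ᵍ 16) ^ᵍ m)        ≡⟨ ·-assoc w (π ^ᵍ r) ((π ^ᵍ 16) ^ᵍ m) ⟩
  (w · π ^ᵍ r) · (π ^ᵍ 16) ^ᵍ m        ∎
  where open ≡-Reasoning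

1632∣re-·π^-period : ∀ w r m → + 1632 ∣ re (w · π ^ᵍ (r ℕ.+ m ℕ.* 16)) - re (w · π ^ᵍ r)
1632∣re-·π^-period w r m =
  let t , π¹⁶ᵐ≡ = ^ᵍ-binomial {π ^ᵍ 16} {+ 1632} {+ 101 , + 217} π¹⁶≡1+1632 m
      e       = + m ⊙ (+ 101 , + 217) +ᵍ + 1632 ⊙ t
  in divides (re (h · e)) (begin
  re (w · π ^ᵍ (r ℕ.+ m ℕ.* 16)) - re h     ≡⟨ cong (λ z → re z - re h) (·π^-split w r m) ⟩
  re (h · (π ^ᵍ 16) ^ᵍ m) - re h            ≡⟨ cong (λ z → re (h · z) - re h) π¹⁶ᵐ≡ ⟩
  re (h · (1ᵍ +ᵍ + 1632 ⊙ e)) - re h        ≡⟨ cong (_- re h) (re-·-1+ h (+ 1632) e) ⟩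
  (re h + + 1632 * re (h · e)) - re h       ≡⟨ cancel (re h) (re (h · e)) ⟩
  re (h · e) * + 1632                       ∎)
  where
  open ≡-Reasoning
  h : Gaussian
  h = w · π ^ᵍ r
  cancel : ∀ a b → (a + + 1632 * b) - a ≡ b * + 1632
  cancel = solve-∀

-- Either no exponent n ≡ r (mod 16) solves re (w πⁿ) = c, or r does and is the only one.
ResidueClassChecked : ℤ → List ℕ → Gaussian → ℕ → Set
ResidueClassChecked c S w r =
  ¬ (+ 1632 ∣ c - re (w · π ^ᵍ r))
  ⊎ (re (w · π ^ᵍ r) ≡ c × r ∈ S × ¬ (+ 16 ∣ re (w · π ^ᵍ r · δ)))

residueClassChecked? : ∀ c S w r → Dec (ResidueClassChecked c S w r)
residueClassChecked? c S w r =
  ¬? (+ 1632 ∣? c - re (w · π ^ᵍ r))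
  ⊎-dec (re (w · π ^ᵍ r) ℤₚ.≟ c ×-dec r ∈? S ×-dec ¬? (+ 16 ∣? re (w · π ^ᵍ r · δ)))

exponent-in-residue-class : ∀ {c S w r} → ResidueClassChecked c S w r →
                            ∀ m → re (w · π ^ᵍ (r ℕ.+ m ℕ.* 16)) ≡ c → r ℕ.+ m ℕ.* 16 ∈ S
exponent-in-residue-class {w = w} {r} (inj₁ 1632∤) m wπⁿ≡c =
  ⊥-elim (1632∤ (subst (λ z → + 1632 ∣ z - re (w · π ^ᵍ r)) wπⁿ≡c (1632∣re-·π^-period w r m)))
exponent-in-residue-class {S = S} {r = r} (inj₂ (_ , r∈S , _)) zero _ =
  subst (_∈ S) (sym (ℕₚ.+-identityʳ r)) r∈S
exponent-in-residue-class {c} {w = w} {r} (inj₂ (wπʳ≡c , _ , 16∤)) (suc m) wπⁿ≡c =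
  ⊥-elim (re-·-^ᵍ-suc≢re {π ^ᵍ 16} {δ} π¹⁶≡1+32δ (w · π ^ᵍ r) 16∤ m (begin
    re ((w · π ^ᵍ r) · (π ^ᵍ 16) ^ᵍ suc m)  ≡⟨ cong re (·π^-split w r (suc m)) ⟨
    re (w · π ^ᵍ (r ℕ.+ suc m ℕ.* 16))      ≡⟨ wπⁿ≡c ⟩
    c                                        ≡⟨ wπʳ≡c ⟨
    re (w · π ^ᵍ r)                          ∎))
  where open ≡-Reasoning

exponent-in-residue-classes : ∀ {c S w} → (∀ (r : Fin 16) → ResidueClassChecked c S w (toℕ r)) →
                              ∀ n → re (w · π ^ᵍ n) ≡ c → n ∈ S
exponent-in-residue-classes {c} {S} {w} checked n wπⁿ≡c =
  subst (_∈ S) (sym n≡r+q*16) (exponent-in-residue-class {c} {S} {w} {n % 16} r-checked (n / 16)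
                                 (subst (λ k → re (w · π ^ᵍ k) ≡ c) n≡r+q*16 wπⁿ≡c))
  where
  n≡r+q*16 : n ≡ n % 16 ℕ.+ (n / 16) ℕ.* 16
  n≡r+q*16 = m≡m%n+[m/n]*n n 16
  r-checked : ResidueClassChecked c S w (n % 16)
  r-checked = subst (ResidueClassChecked c S w) (Finₚ.toℕ-fromℕ< (m%n<n n 16))
                    (checked (fromℕ< (m%n<n n 16)))

orbit : Gaussian → List Gaussian
orbit ℓ = map (ℓ ·_) units ++ map (conj ℓ ·_) units

re-·-orbit : ∀ ℓ p n → AssociatedUpToConj p (π ^ᵍ n) → ∃ λ w → w ∈ orbit ℓ × re (ℓ · p) ≡ re (w · π ^ᵍ n)
re-·-orbit ℓ p n (inj₁ (u , u∈ , p≡uπⁿ)) =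
  ℓ · u , ∈-++⁺ˡ (∈-map⁺ (ℓ ·_) u∈) , cong re (trans (cong (ℓ ·_) p≡uπⁿ) (·-assoc ℓ u (π ^ᵍ n)))
re-·-orbit ℓ p n (inj₂ (u , u∈ , p̄≡uπⁿ)) =
  conj ℓ · u , ∈-++⁺ʳ (map (ℓ ·_) units) (∈-map⁺ (conj ℓ ·_) u∈) , (begin
    re (ℓ · p)                   ≡⟨⟩
    re (conj (ℓ · p))            ≡⟨ cong re (conj-· ℓ p) ⟩
    re (conj ℓ · conj p)         ≡⟨ cong (λ z → re (conj ℓ · z)) p̄≡uπⁿ ⟩
    re (conj ℓ · (u · π ^ᵍ n))   ≡⟨ cong re (·-assoc (conj ℓ) u (π ^ᵍ n)) ⟩
    re (conj ℓ · u · π ^ᵍ n)     ∎)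
  where open ≡-Reasoning

Checked : Gaussian → ℤ → List ℕ → Set
Checked ℓ c S = All.All (λ w → ∀ (r : Fin 16) → ResidueClassChecked c S w (toℕ r)) (orbit ℓ)

checked? : ∀ ℓ c S → Dec (Checked ℓ c S)
checked? ℓ c S = All.all? (λ w → Finₚ.all? (λ r → residueClassChecked? c S w (toℕ r))) (orbit ℓ)

exponent-from-norm : ∀ ℓ c S → Checked ℓ c S → ¬ (+ 5 ∣ c) →
                     ∀ n p → norm p ≡ + (5 ^ n) → re (ℓ · p) ≡ c → n ∈ S
exponent-from-norm ℓ c S checked 5∤c n p np ℓp≡c =
  let w , w∈ , ℓp≡wπⁿ = re-·-orbit ℓ p n (descent n p np 5∤p)
  in exponent-in-residue-classes {c} {S} {w} (All.lookup checked w∈) n (trans (sym ℓp≡wπⁿ) ℓp≡c)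
  where
  5∤p : ¬ (+ 5 ∣ᵍ p)
  5∤p 5∣p = 5∤c (subst (+ 5 ∣_) ℓp≡c (proj₁ (∣ᵍ-·ˡ ℓ 5∣p)))

Eqn⇒ℤ : ∀ {i a n y} → Eqn i a n y → + (2 ^ i) * + (5 ^ n) ≡ + a + + y * + y
Eqn⇒ℤ {i} {a} {n} {y} e = begin
  + (2 ^ i) * + (5 ^ n)      ≡⟨ ℤₚ.pos-* (2 ^ i) (5 ^ n) ⟨
  + (2 ^ i ℕ.* 5 ^ n)        ≡⟨ cong +_ e ⟩
  + a + + (y ℕ.* (y ℕ.* 1))  ≡⟨ cong (λ z → + a + + (y ℕ.* z)) (ℕₚ.*-identityʳ y) ⟩
  + a + + (y ℕ.* y)          ≡⟨ cong (λ z → + a + z) (ℤₚ.pos-* y y) ⟩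
  + a + + y * + y            ∎
  where open ≡-Reasoning

exponent-of-sum-of-squares : ∀ k S {_ : True (checked? 1ᵍ (+ k) S)} {_ : False (+ 5 ∣? + k)} →
                             ∀ n y → Eqn 0 (k ℕ.* k) n y → n ∈ S
exponent-of-sum-of-squares k S {checked} {5∤k} n y e =
  exponent-from-norm 1ᵍ (+ k) S (toWitness checked) (toWitnessFalse 5∤k) n (+ k , + y) k²+y²≡5ⁿ
    (cong re (·-identityˡ (+ k , + y)))
  where
  open ≡-Reasoning
  k²+y²≡5ⁿ : norm (+ k , + y) ≡ + (5 ^ n)
  k²+y²≡5ⁿ = begin
    + k * + k + + y * + y      ≡⟨ cong (λ z → z + + y * + y) (ℤₚ.pos-* k k) ⟨
    + (k ℕ.* k) + + y * + y    ≡⟨ Eqn⇒ℤ {0} {k ℕ.* k} {n} {y} e ⟨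
    + 1 * + (5 ^ n)            ≡⟨ ℤₚ.*-identityˡ (+ (5 ^ n)) ⟩
    + (5 ^ n)                  ∎

-- With y = 2h + 1 and c = 2b + 1, the element p = ((y + c)/2 , (y − c)/2) has norm 5ⁿ and
-- re ((1 + i) p) = c.
exponent-of-twice-sum-of-squares :
  ∀ b S {_ : True (checked? (+ 1 , + 1) (+ 1 + + 2 * + b) S)} {_ : False (+ 5 ∣? + 1 + + 2 * + b)} →
  ∀ n h → Eqn 1 (suc (2 ℕ.* b) ℕ.* suc (2 ℕ.* b)) n (suc (2 ℕ.* h)) → n ∈ S
exponent-of-twice-sum-of-squares b S {checked} {5∤c} n h e =
  exponent-from-norm (+ 1 , + 1) (+ 1 + + 2 * + b) S (toWitness checked) (toWitnessFalse 5∤c) n p normp≡5ⁿ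
    (difference (+ h) (+ b))
  where
  open ≡-Reasoning
  p : Gaussian
  p = (+ h + + b + + 1 , + h - + b)
  difference : ∀ H B → + 1 * (H + B + + 1) - + 1 * (H - B) ≡ + 1 + + 2 * B
  difference = solve-∀
  halve : ∀ H B → + 2 * ((H + B + + 1) * (H + B + + 1) + (H - B) * (H - B))
                ≡ (+ 1 + + 2 * B) * (+ 1 + + 2 * B) + (+ 1 + + 2 * H) * (+ 1 + + 2 * H)
  halve = solve-∀
  normp≡5ⁿ : norm p ≡ + (5 ^ n)
  normp≡5ⁿ = ℤₚ.*-cancelˡ-≡ (+ 2) (norm p) (+ (5 ^ n)) (begin
    + 2 * norm p                                                     ≡⟨ halve (+ h) (+ b) ⟩
    (+ 1 + + 2 * + b) * (+ 1 + + 2 * + b) + (+ 1 + + 2 * + h) * (+ 1 + + 2 * + h)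
      ≡⟨ cong₂ (λ u v → u * u + v * v) (pos-odd b) (pos-odd h) ⟨
    + suc (2 ℕ.* b) * + suc (2 ℕ.* b) + + suc (2 ℕ.* h) * + suc (2 ℕ.* h)
      ≡⟨ cong (λ z → z + + suc (2 ℕ.* h) * + suc (2 ℕ.* h)) (ℤₚ.pos-* (suc (2 ℕ.* b)) (suc (2 ℕ.* b))) ⟨
    + (suc (2 ℕ.* b) ℕ.* suc (2 ℕ.* b)) + + suc (2 ℕ.* h) * + suc (2 ℕ.* h)
      ≡⟨ Eqn⇒ℤ {1} {suc (2 ℕ.* b) ℕ.* suc (2 ℕ.* b)} {n} {suc (2 ℕ.* h)} e ⟨
    + 2 * + (5 ^ n)                                                  ∎)

square-root : ∀ a k {y} → a ℕ.+ k ^ 2 ≡ a ℕ.+ y ^ 2 → y ≡ k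
square-root a k {y} a+k²≡a+y² with ℕₚ.<-cmp y k
... | tri< y<k _ _ = ⊥-elim (ℕₚ.<-irrefl (sym k²≡y²) (ℕₚ.^-monoˡ-< 2 y<k))
  where k²≡y² = ℕₚ.+-cancelˡ-≡ a _ _ a+k²≡a+y²
... | tri≈ _ y≡k _ = y≡k
... | tri> _ _ k<y = ⊥-elim (ℕₚ.<-irrefl k²≡y² (ℕₚ.^-monoˡ-< 2 k<y))
  where k²≡y² = ℕₚ.+-cancelˡ-≡ a _ _ a+k²≡a+y²

odd+even²≢2·5ⁿ : ∀ b n h → ¬ Eqn 1 (suc (2 ℕ.* b)) n (2 ℕ.* h)
odd+even²≢2·5ⁿ b n h e = ℕₚ.even≢odd (5 ^ n) (b ℕ.+ 2 ℕ.* (h ℕ.* h)) (trans e (regroup b h))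
  where
  regroup : ∀ b h → suc (2 ℕ.* b) ℕ.+ 2 ℕ.* h ℕ.* (2 ℕ.* h ℕ.* 1) ≡ suc (2 ℕ.* (b ℕ.+ 2 ℕ.* (h ℕ.* h)))
  regroup = ℕ-Solver.solve-∀

5^n-odd : ∀ n → ∃ λ k → 5 ^ n ≡ suc (2 ℕ.* k)
5^n-odd zero    = 0 , refl
5^n-odd (suc n) = let k , 5ⁿ≡2k+1 = 5^n-odd n in 2 ℕ.+ 5 ℕ.* k , trans (cong (5 ℕ.*_) 5ⁿ≡2k+1) (regroup k)
  where
  regroup : ∀ k → 5 ℕ.* suc (2 ℕ.* k) ≡ suc (2 ℕ.* (2 ℕ.+ 5 ℕ.* k))
  regroup = ℕ-Solver.solve-∀

no-solution-1-4 : ∀ n y → ¬ Eqn 1 4 n y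
no-solution-1-4 n y e with even-or-odd y
... | h , inj₁ refl =
  let k , 5ⁿ≡2k+1 = 5^n-odd n
  in ℕₚ.even≢odd (suc (h ℕ.* h)) k (trans (sym (ℕₚ.*-cancelˡ-≡ (5 ^ n) _ 2 (trans e (regroup h)))) 5ⁿ≡2k+1)
  where
  regroup : ∀ h → 4 ℕ.+ 2 ℕ.* h ℕ.* (2 ℕ.* h ℕ.* 1) ≡ 2 ℕ.* (2 ℕ.* suc (h ℕ.* h))
  regroup = ℕ-Solver.solve-∀
... | h , inj₂ refl = ℕₚ.even≢odd (5 ^ n) (2 ℕ.+ 2 ℕ.* h ℕ.+ 2 ℕ.* (h ℕ.* h)) (trans e (regroup h))
  where
  regroup : ∀ h → 4 ℕ.+ suc (2 ℕ.* h) ℕ.* (suc (2 ℕ.* h) ℕ.* 1) ≡ suc (2 ℕ.* (2 ℕ.+ 2 ℕ.* h ℕ.+ 2 ℕ.* (h ℕ.* h)))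
  regroup = ℕ-Solver.solve-∀

solutions-0-1 : SolutionsExactly 0 1 ((1 , 2) ∷ [])
solutions-0-1 n y =
  (λ e → at {n} {y} (exponent-of-sum-of-squares 1 (0 ∷ 1 ∷ []) (suc n) (suc y) e) e) ,
  λ { (here refl) → refl ; (there ()) }
  where
  at : ∀ {n y} → suc n ∈ 0 ∷ 1 ∷ [] → Eqn 0 1 (suc n) (suc y) → (suc n , suc y) ∈ (1 , 2) ∷ []
  at (there (here refl)) e = here (cong (1 ,_) (square-root 1 2 e))
  at (there (there ()))  _

solutions-0-4 : SolutionsExactly 0 4 ((1 , 1) ∷ (3 , 11) ∷ [])
solutions-0-4 n y =
  (λ e → at {n} {y} (exponent-of-sum-of-squares 2 (1 ∷ 3 ∷ []) (suc n) (suc y) e) e) ,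
  λ { (here refl) → refl ; (there (here refl)) → refl ; (there (there ())) }
  where
  at : ∀ {n y} → suc n ∈ 1 ∷ 3 ∷ [] → Eqn 0 4 (suc n) (suc y) → (suc n , suc y) ∈ (1 , 1) ∷ (3 , 11) ∷ []
  at (here refl)         e = here (cong (1 ,_) (square-root 4 1 e))
  at (there (here refl)) e = there (here (cong (3 ,_) (square-root 4 11 e)))
  at (there (there ()))  _

solutions-0-9 : SolutionsExactly 0 9 ((2 , 4) ∷ [])
solutions-0-9 n y =
  (λ e → at {n} {y} (exponent-of-sum-of-squares 3 (2 ∷ []) (suc n) (suc y) e) e) ,
  λ { (here refl) → refl ; (there ()) }
  where
  at : ∀ {n y} → suc n ∈ 2 ∷ [] → Eqn 0 9 (suc n) (suc y) → (suc n , suc y) ∈ (2 , 4) ∷ []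
  at (here refl) e = here (cong (2 ,_) (square-root 9 4 e))
  at (there ())  _

solutions-1-1 : SolutionsExactly 1 1 ((1 , 3) ∷ (2 , 7) ∷ [])
solutions-1-1 n y = complete , λ { (here refl) → refl ; (there (here refl)) → refl ; (there (there ())) }
  where
  at : ∀ {n y} → suc n ∈ 0 ∷ 1 ∷ 2 ∷ [] → Eqn 1 1 (suc n) (suc y) → (suc n , suc y) ∈ (1 , 3) ∷ (2 , 7) ∷ []
  at (there (here refl))         e = here (cong (1 ,_) (square-root 1 3 e))
  at (there (there (here refl))) e = there (here (cong (2 ,_) (square-root 1 7 e)))
  at (there (there (there ())))  _
  complete : Eqn 1 1 (suc n) (suc y) → (suc n , suc y) ∈ (1 , 3) ∷ (2 , 7) ∷ []
  complete e with even-or-odd (suc y)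
  ... | h , inj₁ y≡2h   = ⊥-elim (odd+even²≢2·5ⁿ 0 (suc n) h (subst (Eqn 1 1 (suc n)) y≡2h e))
  ... | h , inj₂ y≡2h+1 =
    at {n} {y} (exponent-of-twice-sum-of-squares 0 (0 ∷ 1 ∷ 2 ∷ []) (suc n) h (subst (Eqn 1 1 (suc n)) y≡2h+1 e)) e

solutions-1-9 : SolutionsExactly 1 9 ((1 , 1) ∷ (5 , 79) ∷ [])
solutions-1-9 n y = complete , λ { (here refl) → refl ; (there (here refl)) → refl ; (there (there ())) }
  where
  at : ∀ {n y} → suc n ∈ 1 ∷ 5 ∷ [] → Eqn 1 9 (suc n) (suc y) → (suc n , suc y) ∈ (1 , 1) ∷ (5 , 79) ∷ []
  at (here refl)         e = here (cong (1 ,_) (square-root 9 1 e))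
  at (there (here refl)) e = there (here (cong (5 ,_) (square-root 9 79 e)))
  at (there (there ()))  _
  complete : Eqn 1 9 (suc n) (suc y) → (suc n , suc y) ∈ (1 , 1) ∷ (5 , 79) ∷ []
  complete e with even-or-odd (suc y)
  ... | h , inj₁ y≡2h   = ⊥-elim (odd+even²≢2·5ⁿ 4 (suc n) h (subst (Eqn 1 9 (suc n)) y≡2h e))
  ... | h , inj₂ y≡2h+1 =
    at {n} {y} (exponent-of-twice-sum-of-squares 1 (1 ∷ 5 ∷ []) (suc n) h (subst (Eqn 1 9 (suc n)) y≡2h+1 e)) e

solutions-1-4 : SolutionsExactly 1 4 []
solutions-1-4 n y = ⊥-elim ∘ no-solution-1-4 (suc n) (suc y) , λ ()

lemma2p7 : SolutionsExactly 0 1 ((1 , 2) ∷ [])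
           × SolutionsExactly 0 4 ((1 , 1) ∷ (3 , 11) ∷ [])
           × SolutionsExactly 0 9 ((2 , 4) ∷ [])
           × SolutionsExactly 1 1 ((1 , 3) ∷ (2 , 7) ∷ [])
           × SolutionsExactly 1 9 ((1 , 1) ∷ (5 , 79) ∷ [])
           × SolutionsExactly 1 4 []
lemma2p7 = solutions-0-1 , solutions-0-4 , solutions-0-9 , solutions-1-1 , solutions-1-9 , solutions-1-4
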